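{- Let $k\ge 2$ and let $\mathcal{H}=(V,\mathcal{E})$ be a $k$-uniform 2-hypertree. Then there is a unique decomposition of $\mathcal{E}$ into edge-disjoint maximal stars; i.e., the maximal stars of $\mathcal{H}$ form a partition of $\mathcal{E}$.
   Context: A $k$-uniform hypergraph $\mathcal{H}=(V,\mathcal{E})$ consists of a finite vertex set $V$ and a set $\mathcal{E}$ of $k$-element subsets of $V$ (no multiple edges). A $k$-uniform hypergraph is a chain if there is a sequence $v_1,\dots,v_l$ of its vertices in which every vertex appears at least once (possibly more times), $v_1\ne v_l$, and its edge set consists of exactly the $l-k+1$ distinct sets $\{v_i,\dots,v_{i+k-1}\}$, $1\le i\le l-k+1$; it is a semicycle if the same holds with $v_1=v_l$ instead. Length = number of edges. $\mathcal{H}$ is chain-connected if every pair of distinct vertices is contained in some subhypergraph that is a chain; semicycle-free if no subhypergraph is a semicycle. A hypertree is a chain-connected, semicycle-free $k$-uniform hypergraph; a 2-hypertree is a hypertree in which every chain (subhypergraph) has length at most 2. A star of $\mathcal{H}$ is a nonempty set $S\subseteq\mathcal{E}$ of edges all containing a common $(k-1)$-set (i.e. $|\bigcap S|\ge k-1$); a maximal star is a star not properly contained in another star of $\mathcal{H}$. -}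

module Defs where

open import Data.Nat using (ℕ; zero; suc; _+_; _∸_; _≤_; _<_)
open import Data.Fin using (Fin; zero; suc; toℕ; fromℕ)
open import Data.Fin.Subset using (Subset; _∈_; _⊆_; _⊂_; ∣_∣; Nonempty)
open import Data.Product using (Σ; ∃; _×_; _,_)
open import Function.Definitions using (Injective)
open import Function.Bundles using (_⇔_)
open import Relation.Binary.PropositionalEquality using (_≡_; _≢_)
open import Relation.Nullary using (¬_)

-- A k-uniform hypergraph on vertex set Fin n.  Its edge set is given as an
-- injective enumeration E : Fin m → Subset n (no multiple edges), every edge
-- being a k-element subset of the vertices.
record Hypergraph (n k : ℕ) : Set where
  field
    m        : ℕ
    E        : Fin m → Subset n
    E-inj    : Injective _≡_ _≡_ E
    E-size   : ∀ e → ∣ E e ∣ ≡ k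

module _ {n k : ℕ} (H : Hypergraph n k) where
  open Hypergraph H

  -- A vertex sequence v_1, ..., v_l (here l = suc l') with l ≥ k whose
  -- windows {v_i, ..., v_{i+k-1}} (1 ≤ i ≤ l-k+1) are edges of H, pairwise
  -- distinct.  The subhypergraph it determines has as vertices the vertices
  -- of the sequence and as edges exactly these l-k+1 windows.
  record Walk : Set where
    field
      l'      : ℕ
      seq     : Fin (suc l') → Fin n
      k≤l     : k ≤ suc l'
      win     : Fin (suc (suc l' ∸ k)) → Fin m
      win-inj : Injective _≡_ _≡_ win
      win-ok  : ∀ (i : Fin (suc (suc l' ∸ k))) (x : Fin n) →
                (x ∈ E (win i)) ⇔
                (∃ λ (j : Fin (suc l')) →
                   (toℕ i ≤ toℕ j) × (toℕ j < toℕ i + k) × (seq j ≡ x))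

    -- number of edges of the walk
    length : ℕ
    length = suc (suc l' ∸ k)

    first : Fin n
    first = seq zero

    last : Fin n
    last = seq (fromℕ l')

    Visits : Fin n → Set
    Visits v = ∃ λ j → seq j ≡ v

  IsChain : Walk → Set
  IsChain w = Walk.first w ≢ Walk.last w

  IsSemicycle : Walk → Set
  IsSemicycle w = Walk.first w ≡ Walk.last w

  ChainConnected : Set
  ChainConnected = ∀ (u v : Fin n) → u ≢ v →
    ∃ λ (w : Walk) → IsChain w × Walk.Visits w u × Walk.Visits w v

  SemicycleFree : Set
  SemicycleFree = ∀ (w : Walk) → ¬ IsSemicycle w

  IsHypertree : Set
  IsHypertree = ChainConnected × SemicycleFree

  Is2Hypertree : Set
  Is2Hypertree = IsHypertree × (∀ (w : Walk) → IsChain w → Walk.length w ≤ 2)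

  IsStar : Subset m → Set
  IsStar S = Nonempty S ×
    (∃ λ (T : Subset n) → (∣ T ∣ ≡ k ∸ 1) × (∀ e → e ∈ S → T ⊆ E e))

  IsMaximalStar : Subset m → Set
  IsMaximalStar S = IsStar S × (∀ S' → IsStar S' → ¬ (S ⊂ S'))

  MaximalStarsPartitionEdges : Set
  MaximalStarsPartitionEdges =
    (∀ (e : Fin m) → ∃ λ S → IsMaximalStar S × e ∈ S) ×
    (∀ S S' → IsMaximalStar S → IsMaximalStar S' →
       ∀ e → e ∈ S → e ∈ S' → S ≡ S')

module Submission where

-- Write k = r + 2 and call a (k-1)-subset T of an edge e a core of e.
-- The heart of the argument is that in a 2-hypertree an edge e has at most one core
-- shared with another edge: if two distinct cores T = C+b and T' = C+a of e = C+a+b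
-- lie in edges f = C+b+x and g = C+a+y (both different from e), then the vertex
-- sequence  y, a, C, b, x  has the three windows g, e, f, so it is a walk of
-- length 3 -- a semicycle if y = x and a chain of length 3 otherwise; both are
-- excluded.  Consequently a maximal star is exactly the set `starAt T` of all edges
-- containing its core T, two maximal stars through e either have the same core or
-- one of them is {e}, and every edge e lies in the maximal star `starAt T` for T a
-- shared core of e (or any core, if none is shared).

open import Defs
open import Data.Nat using (ℕ; _≤_)

open import Data.Nat using (zero; suc; _+_; _∸_; _<_; z≤n; s≤s)
open import Data.Nat.Properties
  using ( ≤-refl; ≤-reflexive; <⇒≤; ≤⇒≯; n≮n; ≤-<-trans; <-≤-trans; m≤n⇒m<n∨m≡n; m≤m+n
        ; m≤n+m; +-identityʳ; +-suc; m≤o∸n⇒m+n≤o; m+n∸n≡m; suc-injective; 0≢1+n )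
  renaming (_≟_ to _≟ℕ_)
open import Data.Bool using () renaming (_≟_ to _≟ᵇ_)
open import Data.Fin using (Fin; zero; suc; toℕ; fromℕ<; _≟_)
import Data.Fin as Fin
open import Data.Fin.Properties using (toℕ-injective; toℕ<n; toℕ-fromℕ; toℕ-fromℕ<; any?)
import Data.Fin.Subset as Subset
open import Data.Fin.Subset
  using (Subset; inside; outside; _∈_; _∉_; _⊆_; _⊂_; _∪_; _∩_; _-_; ∁; ⁅_⁆; ∣_∣)
open import Data.Fin.Subset.Properties
  using ( _∈?_; _⊆?_; nonempty?; anySubset?; Empty-unique; ⊆-antisym; p⊂q⇒∣p∣<∣q∣
        ; p⊆q⇒∣p∣≤∣q∣; x∈p∪q⁻; x∈p∪q⁺; ∪⇔⊎; x∈p∩q⁻; x∈p∩q⁺; x∈⁅x⁆; x∈⁅y⁆⇒x≡y; x∈⁅y⁆⇔x≡y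
        ; x∉p⇒x∈∁p; x∈∁p⇒x∉p; p∩q⊆p; p∩q⊆q; p─q⊆p; p─⊥≡p; ∣⊥∣≡0
        ; ∩-comm; ∪-comm; ∪-assoc; ∪-identityˡ )
open import Data.Vec using ([]; _∷_; here; there; tabulate)
open import Data.Vec.Properties using (≡-dec; []=⇒lookup; lookup⇒[]=; lookup∘tabulate)
open import Data.List using (List; []; _∷_; length; map)
open import Data.List.Properties using (length-map)
open import Data.List.Membership.Propositional using () renaming (_∈_ to _∈ₗ_)
open import Data.List.Membership.Propositional.Properties using (∈-map⁺; ∈-map⁻)
import Data.List.Relation.Unary.Any as Any
open import Data.Product using (Σ; ∃; _×_; _,_; proj₁; proj₂)
open import Data.Sum using (_⊎_; inj₁; inj₂; map₁)
open import Data.Sum.Function.Propositional using (_⊎-⇔_)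
open import Data.Empty using (⊥; ⊥-elim)
open import Function using (_∘_; _⇔_; mk⇔; Equivalence)
open import Function.Properties.Equivalence
  using () renaming (refl to ⇔-refl; sym to ⇔-sym; trans to ⇔-trans)
open import Relation.Nullary using (¬_; Dec; yes; no; does)
open import Relation.Nullary.Decidable using (_×-dec_; ¬?; dec-true)
open import Relation.Unary using (Decidable)
open import Relation.Binary.PropositionalEquality
  using (_≡_; _≢_; refl; sym; trans; cong; subst; module ≡-Reasoning)

private variable
  A : Set
  n i len : ℕ
  p q X T T' : Subset n
  u w z : Fin n

∣⁅z⁆∪p∣≡1+∣p∣ : z ∉ p → ∣ ⁅ z ⁆ ∪ p ∣ ≡ suc ∣ p ∣
∣⁅z⁆∪p∣≡1+∣p∣ {z = zero}  {p = inside  ∷ p} z∉p = ⊥-elim (z∉p here)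
∣⁅z⁆∪p∣≡1+∣p∣ {z = zero}  {p = outside ∷ p} _   = cong (suc ∘ ∣_∣) (∪-identityˡ p)
∣⁅z⁆∪p∣≡1+∣p∣ {z = suc z} {p = inside  ∷ p} z∉p = cong suc (∣⁅z⁆∪p∣≡1+∣p∣ (z∉p ∘ there))
∣⁅z⁆∪p∣≡1+∣p∣ {z = suc z} {p = outside ∷ p} z∉p = ∣⁅z⁆∪p∣≡1+∣p∣ (z∉p ∘ there)

∣p∣≡1+∣p-z∣ : z ∈ p → ∣ p ∣ ≡ suc ∣ p - z ∣
∣p∣≡1+∣p-z∣ {z = zero}  {p = inside  ∷ p} here        = cong (suc ∘ ∣_∣) (sym (p─⊥≡p p))
∣p∣≡1+∣p-z∣ {z = suc z} {p = inside  ∷ p} (there z∈p) = cong suc (∣p∣≡1+∣p-z∣ z∈p)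
∣p∣≡1+∣p-z∣ {z = suc z} {p = outside ∷ p} (there z∈p) = ∣p∣≡1+∣p-z∣ z∈p

p⊆q∧∣q∣≤∣p∣⇒p≡q : p ⊆ q → ∣ q ∣ ≤ ∣ p ∣ → p ≡ q
p⊆q∧∣q∣≤∣p∣⇒p≡q {p = p} {q = q} p⊆q ∣q∣≤∣p∣ = ⊆-antisym p⊆q q⊆p
  where
  q⊆p : q ⊆ p
  q⊆p {w} w∈q with w ∈? p
  ... | yes w∈p = w∈p
  ... | no  w∉p = ⊥-elim (≤⇒≯ ∣q∣≤∣p∣ (p⊂q⇒∣p∣<∣q∣ (p⊆q , w , w∈q , w∉p)))

⁅z⁆∪p⊆q : z ∈ q → p ⊆ q → ⁅ z ⁆ ∪ p ⊆ q
⁅z⁆∪p⊆q {z = z} {q = q} {p = p} z∈q p⊆q w∈ with x∈p∪q⁻ ⁅ z ⁆ p w∈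
... | inj₁ w∈⁅z⁆ = subst (_∈ q) (sym (x∈⁅y⁆⇒x≡y z w∈⁅z⁆)) z∈q
... | inj₂ w∈p   = p⊆q w∈p

∈-⁅u⁆∪p-other : w ∈ ⁅ u ⁆ ∪ p → w ≢ u → w ∈ p
∈-⁅u⁆∪p-other {u = u} {p = p} w∈ w≢u with x∈p∪q⁻ ⁅ u ⁆ p w∈
... | inj₁ w∈⁅u⁆ = ⊥-elim (w≢u (x∈⁅y⁆⇒x≡y u w∈⁅u⁆))
... | inj₂ w∈p   = w∈p

u∈⁅u⁆∪p : u ∈ ⁅ u ⁆ ∪ p
u∈⁅u⁆∪p {u = u} = x∈p∪q⁺ (inj₁ (x∈⁅x⁆ u))

one-more-element : p ⊆ q → ∣ q ∣ ≡ suc ∣ p ∣ → ∃ λ z → z ∉ p × q ≡ ⁅ z ⁆ ∪ p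
one-more-element {p = p} {q = q} p⊆q ∣q∣≡ with nonempty? (q ∩ ∁ p)
... | yes (z , z∈q∖p) = z , z∉p , sym (p⊆q∧∣q∣≤∣p∣⇒p≡q (⁅z⁆∪p⊆q z∈q p⊆q) same-size)
  where
  z∈q : z ∈ q
  z∈q = proj₁ (x∈p∩q⁻ q (∁ p) z∈q∖p)
  z∉p : z ∉ p
  z∉p = x∈∁p⇒x∉p (proj₂ (x∈p∩q⁻ q (∁ p) z∈q∖p))
  same-size : ∣ q ∣ ≤ ∣ ⁅ z ⁆ ∪ p ∣
  same-size = ≤-reflexive (trans ∣q∣≡ (sym (∣⁅z⁆∪p∣≡1+∣p∣ z∉p)))
... | no q∖p-empty = ⊥-elim (n≮n ∣ p ∣ (subst (_≤ ∣ p ∣) ∣q∣≡ (p⊆q⇒∣p∣≤∣q∣ q⊆p)))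
  where
  q⊆p : q ⊆ p
  q⊆p {w} w∈q with w ∈? p
  ... | yes w∈p = w∈p
  ... | no  w∉p = ⊥-elim (q∖p-empty (w , x∈p∩q⁺ (w∈q , x∉p⇒x∈∁p w∉p)))

split-off : u ∈ p → p ⊆ ⁅ u ⁆ ∪ q → p ≡ ⁅ u ⁆ ∪ (p ∩ q)
split-off {u = u} {p = p} {q = q} u∈p p⊆ = ⊆-antisym p⊆⁅u⁆∪p∩q (⁅z⁆∪p⊆q u∈p (p∩q⊆p p q))
  where
  p⊆⁅u⁆∪p∩q : p ⊆ ⁅ u ⁆ ∪ (p ∩ q)
  p⊆⁅u⁆∪p∩q w∈p with x∈p∪q⁻ ⁅ u ⁆ q (p⊆ w∈p)
  ... | inj₁ w∈⁅u⁆ = x∈p∪q⁺ (inj₁ w∈⁅u⁆)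
  ... | inj₂ w∈q   = x∈p∪q⁺ (inj₂ (x∈p∩q⁺ (w∈p , w∈q)))

record Exchange (X T T' : Subset n) : Set where
  field
    a b    : Fin n
    C      : Subset n
    X≡a+T  : X ≡ ⁅ a ⁆ ∪ T
    T≡b+C  : T ≡ ⁅ b ⁆ ∪ C
    T'≡a+C : T' ≡ ⁅ a ⁆ ∪ C
    b∉C    : b ∉ C

exchange : T ⊆ X → T' ⊆ X → ∣ X ∣ ≡ suc ∣ T ∣ → ∣ X ∣ ≡ suc ∣ T' ∣ → T ≢ T' →
           Exchange X T T'
exchange {T = T} {X = X} {T' = T'} T⊆X T'⊆X ∣X∣≡1+∣T∣ ∣X∣≡1+∣T'∣ T≢T'
  with one-more-element T⊆X ∣X∣≡1+∣T∣ | one-more-element T'⊆X ∣X∣≡1+∣T'∣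
... | a , a∉T , X≡a+T | b , b∉T' , X≡b+T' = record
  { a = a ; b = b ; C = T ∩ T'
  ; X≡a+T  = X≡a+T
  ; T≡b+C  = split-off b∈T (in-b+T' ∘ T⊆X)
  ; T'≡a+C = trans (split-off a∈T' (in-a+T ∘ T'⊆X)) (cong (⁅ a ⁆ ∪_) (∩-comm T' T))
  ; b∉C    = b∉T' ∘ p∩q⊆q T T'
  }
  where
  in-a+T : w ∈ X → w ∈ ⁅ a ⁆ ∪ T
  in-a+T = subst (_ ∈_) X≡a+T
  in-b+T' : w ∈ X → w ∈ ⁅ b ⁆ ∪ T'
  in-b+T' = subst (_ ∈_) X≡b+T'

  -- if both sets missed the same element of X they would coincide
  a≢b : a ≢ b
  a≢b refl = T≢T' (p⊆q∧∣q∣≤∣p∣⇒p≡q T⊆T' ∣T'∣≤∣T∣)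
    where
    T⊆T' : T ⊆ T'
    T⊆T' w∈T = ∈-⁅u⁆∪p-other (in-b+T' (T⊆X w∈T)) λ { refl → a∉T w∈T }
    ∣T'∣≤∣T∣ : ∣ T' ∣ ≤ ∣ T ∣
    ∣T'∣≤∣T∣ = ≤-reflexive (suc-injective (trans (sym ∣X∣≡1+∣T'∣) ∣X∣≡1+∣T∣))

  b∈T : b ∈ T
  b∈T = ∈-⁅u⁆∪p-other (in-a+T (subst (b ∈_) (sym X≡b+T') u∈⁅u⁆∪p)) (a≢b ∘ sym)

  a∈T' : a ∈ T'
  a∈T' = ∈-⁅u⁆∪p-other (in-b+T' (subst (a ∈_) (sym X≡a+T) u∈⁅u⁆∪p)) a≢b

_≟ˢ_ : (p q : Subset n) → Dec (p ≡ q)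
_≟ˢ_ = ≡-dec _≟ᵇ_

select : ∀ {m} {P : Fin m → Set} → Decidable P → Subset m
select P? = tabulate (does ∘ P?)

∈-select⇔ : ∀ {m} {P : Fin m → Set} (P? : Decidable P) {h : Fin m} → h ∈ select P? ⇔ P h
∈-select⇔ {P = P} P? {h} = mk⇔ to from
  where
  to : h ∈ select P? → P h
  to h∈ with P? h | trans (sym (lookup∘tabulate (does ∘ P?) h)) ([]=⇒lookup h∈)
  ... | yes Ph | _ = Ph
  ... | no  _  | ()
  from : P h → h ∈ select P?
  from Ph = lookup⇒[]= h _ (trans (lookup∘tabulate (does ∘ P?) h) (dec-true (P? h) Ph))

_∪-⇔_ : {P Q : Set} → (w ∈ p ⇔ P) → (w ∈ q ⇔ Q) → (w ∈ p ∪ q ⇔ (P ⊎ Q))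
p⇔ ∪-⇔ q⇔ = ⇔-trans ∪⇔⊎ (p⇔ ⊎-⇔ q⇔)

∈⁅⁆⇔ : ∀ {v} → u ≡ v → (w ∈ ⁅ u ⁆ ⇔ w ≡ v)
∈⁅⁆⇔ refl = x∈⁅y⁆⇔x≡y

≡⇒∈⇔ : p ≡ q → (w ∈ p ⇔ w ∈ q)
≡⇒∈⇔ refl = ⇔-refl

_◂_ : A → (ℕ → A) → ℕ → A
(c ◂ s) zero    = c
(c ◂ s) (suc t) = s t

_++ˢ_ : List A → (ℕ → A) → ℕ → A
[]       ++ˢ s = s
(c ∷ cs) ++ˢ s = c ◂ (cs ++ˢ s)

++ˢ-beyond : (cs : List A) (s : ℕ → A) (t : ℕ) → (cs ++ˢ s) (t + length cs) ≡ s t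
++ˢ-beyond []       s t rewrite +-identityʳ t       = refl
++ˢ-beyond (c ∷ cs) s t rewrite +-suc t (length cs) = ++ˢ-beyond cs s t

Among : (ℕ → A) → ℕ → ℕ → A → Set
Among s i zero      a = ⊥
Among s i (suc len) a = a ≡ s i ⊎ Among s (suc i) len a

Among-◂ : ∀ {s : ℕ → A} {c a} → Among (c ◂ s) (suc i) len a ≡ Among s i len a
Among-◂ {len = zero}    = refl
Among-◂ {len = suc len} = cong (_ ⊎_) (Among-◂ {len = len})

Among-++ˢ : ∀ {s : ℕ → A} {a} (cs : List A) → Among (cs ++ˢ s) 0 (length cs) a ⇔ a ∈ₗ cs
Among-++ˢ []       = mk⇔ (λ ()) (λ ())
Among-++ˢ {s = s} {a} (c ∷ cs)
  rewrite Among-◂ {i = 0} {len = length cs} {s = cs ++ˢ s} {c} {a} =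
  mk⇔ (λ { (inj₁ a≡c) → Any.here a≡c ; (inj₂ a∈) → Any.there (to a∈) })
      (λ { (Any.here a≡c) → inj₁ a≡c ; (Any.there a∈) → inj₂ (from a∈) })
  where open Equivalence (Among-++ˢ {s = s} {a} cs)

Among-snoc : ∀ {s : ℕ → A} {a} → Among s i (suc len) a ⇔ (Among s i len a ⊎ a ≡ s (i + len))
Among-snoc {i = i} {len = zero} rewrite +-identityʳ i =
  mk⇔ (λ { (inj₁ a≡) → inj₂ a≡ }) (λ { (inj₂ a≡) → inj₁ a≡ })
Among-snoc {i = i} {len = suc len} {s} {a} rewrite +-suc i len =
  mk⇔ (λ { (inj₁ a≡) → inj₁ (inj₁ a≡) ; (inj₂ later) → map₁ inj₂ (to later) })
      (λ { (inj₁ (inj₁ a≡)) → inj₁ a≡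
         ; (inj₁ (inj₂ later)) → inj₂ (from (inj₁ later))
         ; (inj₂ a≡) → inj₂ (from (inj₂ a≡)) })
  where open Equivalence (Among-snoc {i = suc i} {len = len} {s} {a})

Among⇔positions : ∀ {s : ℕ → A} {a} → Among s i len a ⇔ (∃ λ t → i ≤ t × t < i + len × a ≡ s t)
Among⇔positions {i = i} {len = zero} rewrite +-identityʳ i =
  mk⇔ (λ ()) (λ { (t , i≤t , t<i , _) → n≮n i (≤-<-trans i≤t t<i) })
Among⇔positions {i = i} {len = suc len} {s} {a} rewrite +-suc i len =
  mk⇔ (λ { (inj₁ a≡) → i , ≤-refl , s≤s (m≤m+n i len) , a≡
         ; (inj₂ later) → let (t , i<t , t< , a≡) = to later in t , <⇒≤ i<t , t< , a≡ })
      (λ { (t , i≤t , t< , a≡) → first-or-later t i≤t t< a≡ })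
  where
  open Equivalence (Among⇔positions {i = suc i} {len = len} {s} {a})
  first-or-later : ∀ t → i ≤ t → t < suc (i + len) → a ≡ s t → Among s i (suc len) a
  first-or-later t i≤t t< a≡ with m≤n⇒m<n∨m≡n i≤t
  ... | inj₁ i<t  = inj₂ (from (t , i<t , t< , a≡))
  ... | inj₂ refl = inj₁ a≡

elements : Subset n → List (Fin n)
elements []            = []
elements (inside  ∷ p) = zero ∷ map Fin.suc (elements p)
elements (outside ∷ p) = map Fin.suc (elements p)

length-elements : (p : Subset n) → length (elements p) ≡ ∣ p ∣
length-elements []            = refl
length-elements (inside  ∷ p) = cong suc (trans (length-map Fin.suc (elements p)) (length-elements p))
length-elements (outside ∷ p) = trans (length-map Fin.suc (elements p)) (length-elements p)

∈-elements : (p : Subset n) → z ∈ₗ elements p ⇔ z ∈ p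
∈-elements p = mk⇔ (to p) (from p)
  where
  to : (p : Subset n) → z ∈ₗ elements p → z ∈ p
  to-later : ∀ {b} (p : Subset n) → z ∈ₗ map Fin.suc (elements p) → z ∈ b ∷ p
  to (inside  ∷ p) (Any.here refl) = here
  to (inside  ∷ p) (Any.there z∈)  = to-later p z∈
  to (outside ∷ p) z∈              = to-later p z∈
  to-later p z∈ with ∈-map⁻ Fin.suc z∈
  ... | _ , v∈ , refl = there (to p v∈)

  from : (p : Subset n) → z ∈ p → z ∈ₗ elements p
  from (inside  ∷ p) here        = Any.here refl
  from (inside  ∷ p) (there z∈)  = Any.there (∈-map⁺ Fin.suc (from p z∈))
  from (outside ∷ p) (there z∈)  = ∈-map⁺ Fin.suc (from p z∈)

module Walks {n k : ℕ} (H : Hypergraph n k) where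
  open Hypergraph H

  positions⇔indices : ∀ {l'} {s : ℕ → Fin n} → i + k ≤ suc l' →
    (∃ λ t → i ≤ t × t < i + k × w ≡ s t) ⇔
    (∃ λ (j : Fin (suc l')) → i ≤ toℕ j × toℕ j < i + k × s (toℕ j) ≡ w)
  positions⇔indices {i = i} {w = w} {l'} {s} i+k≤ =
    mk⇔ to (λ { (j , i≤j , j<i+k , sj≡w) → toℕ j , i≤j , j<i+k , sym sj≡w })
    where
    to : (∃ λ t → i ≤ t × t < i + k × w ≡ s t) →
         ∃ λ (j : Fin (suc l')) → i ≤ toℕ j × toℕ j < i + k × s (toℕ j) ≡ w
    to (t , i≤t , t<i+k , w≡st) =
      fromℕ< t<l , subst (i ≤_) (sym t≡) i≤t , subst (_< i + k) (sym t≡) t<i+k , trans (cong s t≡) (sym w≡st)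
      where
      t<l : t < suc l'
      t<l = <-≤-trans t<i+k i+k≤
      t≡ : toℕ (fromℕ< t<l) ≡ t
      t≡ = toℕ-fromℕ< t<l

  module WalkFromWindows (l' : ℕ) (s : ℕ → Fin n) (k≤l : k ≤ suc l') (pick : ℕ → Fin m)
    (pick-inj : ∀ {i j} → i < suc (suc l' ∸ k) → j < suc (suc l' ∸ k) → pick i ≡ pick j → i ≡ j)
    (pick-window : ∀ {i} → i < suc (suc l' ∸ k) → ∀ w → w ∈ E (pick i) ⇔ Among s i k w)
    where

    window-fits : i < suc (suc l' ∸ k) → i + k ≤ suc l'
    window-fits (s≤s i≤) = m≤o∸n⇒m+n≤o _ k≤l i≤

    walk : Walk H
    walk = record
      { l'      = l'
      ; seq     = s ∘ toℕ
      ; k≤l     = k≤l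
      ; win     = pick ∘ toℕ
      ; win-inj = λ {i} {j} eq → toℕ-injective (pick-inj (toℕ<n i) (toℕ<n j) eq)
      ; win-ok  = λ i w → ⇔-trans (pick-window (toℕ<n i) w)
                          (⇔-trans Among⇔positions (positions⇔indices (window-fits (toℕ<n i))))
      }

    walk-last : Walk.last walk ≡ s l'
    walk-last = cong s (toℕ-fromℕ l')

  walk-length≤2 : Is2Hypertree H → (W : Walk H) → Walk.length W ≤ 2
  walk-length≤2 ((_ , semicycle-free) , short-chains) W with Walk.first W ≟ Walk.last W
  ... | yes closed = ⊥-elim (semicycle-free W closed)
  ... | no  not-closed = short-chains W not-closed

module ThreeEdgeWalk {n r : ℕ} (H : Hypergraph n (suc (suc r))) where
  open Hypergraph H
  open Walks H

  three-edge-walk : (C : Subset n) → ∣ C ∣ ≡ r → (y a b x : Fin n) (g e f : Fin m) →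
    g ≢ e → e ≢ f → g ≢ f →
    E g ≡ ⁅ y ⁆ ∪ ⁅ a ⁆ ∪ C → E e ≡ (⁅ a ⁆ ∪ C) ∪ ⁅ b ⁆ → E f ≡ (C ∪ ⁅ b ⁆) ∪ ⁅ x ⁆ →
    Σ (Walk H) λ W → Walk.first W ≡ y × Walk.last W ≡ x × Walk.length W ≡ 3
  three-edge-walk C ∣C∣≡r y a b x g e f g≢e e≢f g≢f Eg Ee Ef =
    walk , refl , trans walk-last x-at , cong suc three-windows
    where
    cs : List (Fin n)
    cs = elements C
    ∣cs∣≡r : length cs ≡ r
    ∣cs∣≡r = trans (length-elements C) ∣C∣≡r

    l' : ℕ
    l' = suc (suc (suc r))
    k≤l : suc (suc r) ≤ suc l'
    k≤l = m≤n+m (suc (suc r)) 2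
    three-windows : suc l' ∸ suc (suc r) ≡ 2
    three-windows = m+n∸n≡m 2 r

    -- the vertex sequence y, a, c₁, …, c_r, b, x  (padded with x beyond position l')
    ends : ℕ → Fin n
    ends = b ◂ (x ◂ λ _ → x)
    sq : ℕ → Fin n
    sq = y ◂ (a ◂ (cs ++ˢ ends))

    middle : w ∈ C ⇔ Among sq 2 r w
    middle {w = w} =
      subst (λ len → w ∈ C ⇔ Among sq 2 len w) ∣cs∣≡r
        (subst (w ∈ C ⇔_) (sym (trans (Among-◂ {len = length cs}) Among-◂))
          (⇔-sym (⇔-trans (Among-++ˢ cs) (∈-elements C))))

    b-at : sq (2 + r) ≡ b
    b-at = subst (λ t → (cs ++ˢ ends) t ≡ b) ∣cs∣≡r (++ˢ-beyond cs ends 0)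
    x-at : sq (3 + r) ≡ x
    x-at = subst (λ t → (cs ++ˢ ends) (suc t) ≡ x) ∣cs∣≡r (++ˢ-beyond cs ends 1)

    pick : ℕ → Fin m
    pick 0             = g
    pick 1             = e
    pick (suc (suc _)) = f

    window-index : i < suc (suc l' ∸ suc (suc r)) → i ≤ 2
    window-index {i} (s≤s i≤) = subst (i ≤_) three-windows i≤

    window : ∀ i → i ≤ 2 → ∀ w → w ∈ E (pick i) ⇔ Among sq i (suc (suc r)) w
    window 0 _ w = ⇔-trans (≡⇒∈⇔ Eg) (∈⁅⁆⇔ refl ∪-⇔ (∈⁅⁆⇔ refl ∪-⇔ middle))
    window 1 _ w = ⇔-trans (≡⇒∈⇔ Ee)
      (⇔-trans ((∈⁅⁆⇔ refl ∪-⇔ middle) ∪-⇔ ∈⁅⁆⇔ (sym b-at)) (⇔-sym Among-snoc))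
    window 2 _ w = ⇔-trans (≡⇒∈⇔ Ef)
      (⇔-trans ((middle ∪-⇔ ∈⁅⁆⇔ (sym b-at)) ∪-⇔ ∈⁅⁆⇔ (sym x-at))
        (⇔-trans (⇔-sym Among-snoc ⊎-⇔ ⇔-refl) (⇔-sym Among-snoc)))
    window (suc (suc (suc _))) (s≤s (s≤s ()))

    pick-inj : ∀ {i j} → i ≤ 2 → j ≤ 2 → pick i ≡ pick j → i ≡ j
    pick-inj {0} {0} _ _ _   = refl
    pick-inj {0} {1} _ _ g≡e = ⊥-elim (g≢e g≡e)
    pick-inj {0} {2} _ _ g≡f = ⊥-elim (g≢f g≡f)
    pick-inj {1} {0} _ _ e≡g = ⊥-elim (g≢e (sym e≡g))
    pick-inj {1} {1} _ _ _   = refl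
    pick-inj {1} {2} _ _ e≡f = ⊥-elim (e≢f e≡f)
    pick-inj {2} {0} _ _ f≡g = ⊥-elim (g≢f (sym f≡g))
    pick-inj {2} {1} _ _ f≡e = ⊥-elim (e≢f (sym f≡e))
    pick-inj {2} {2} _ _ _   = refl
    pick-inj {suc (suc (suc _))} (s≤s (s≤s ()))
    pick-inj {j = suc (suc (suc _))} _ (s≤s (s≤s ()))

    open WalkFromWindows l' sq k≤l pick
      (λ i< j< → pick-inj (window-index i<) (window-index j<))
      (λ i< → window _ (window-index i<))

module Stars {n r : ℕ} (H : Hypergraph n (suc (suc r))) (h2 : Is2Hypertree H) where
  open Hypergraph H
  open Walks H using (walk-length≤2)
  open ThreeEdgeWalk H using (three-edge-walk)
  open ≡-Reasoning

  private variable
    e f h : Fin m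
    S S' : Subset m

  _CoreOf_ : Subset n → Fin m → Set
  T CoreOf e = ∣ T ∣ ≡ suc r × T ⊆ E e

  coreOf? : ∀ T e → Dec (T CoreOf e)
  coreOf? T e = (∣ T ∣ ≟ℕ suc r) ×-dec (T ⊆? E e)

  SharedBeyond : Fin m → Subset n → Set
  SharedBeyond e T = ∃ λ f → f ≢ e × T ⊆ E f

  sharedBeyond? : ∀ e T → Dec (SharedBeyond e T)
  sharedBeyond? e T = any? (λ f → ¬? (f ≟ e) ×-dec (T ⊆? E f))

  edge-size : (T : Subset n) → ∣ T ∣ ≡ suc r → ∣ E e ∣ ≡ suc ∣ T ∣
  edge-size {e = e} _ ∣T∣ = trans (E-size e) (cong suc (sym ∣T∣))

  edge-extends-core : T CoreOf e → ∃ λ z → z ∉ T × E e ≡ ⁅ z ⁆ ∪ T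
  edge-extends-core {T = T} (∣T∣ , T⊆e) = one-more-element T⊆e (edge-size T ∣T∣)

  some-core : ∀ e → ∃ λ T → T CoreOf e
  some-core e with nonempty? (E e)
  ... | yes (z , z∈e) =
    E e - z , suc-injective (trans (sym (∣p∣≡1+∣p-z∣ z∈e)) (E-size e)) , p─q⊆p (E e) ⁅ z ⁆
  ... | no  e-empty   = ⊥-elim (0≢1+n (begin
    0                ≡⟨ sym (∣⊥∣≡0 n) ⟩
    ∣ Subset.⊥ {n} ∣ ≡⟨ cong ∣_∣ (sym (Empty-unique e-empty)) ⟩
    ∣ E e ∣          ≡⟨ E-size e ⟩
    suc (suc r)      ∎))

  distinct-cores-determine-edge : T ≢ T' → T CoreOf e → T' CoreOf e → T ⊆ E f → T' ⊆ E f → e ≡ f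
  distinct-cores-determine-edge {T = T} {T' = T'} {e = e} {f = f}
    T≢T' (∣T∣ , T⊆e) (∣T'∣ , T'⊆e) T⊆f T'⊆f =
    E-inj (p⊆q∧∣q∣≤∣p∣⇒p≡q e⊆f (≤-reflexive (trans (E-size f) (sym (E-size e)))))
    where
    open Exchange (exchange T⊆e T'⊆e (edge-size T ∣T∣) (edge-size T' ∣T'∣) T≢T')
    e⊆f : E e ⊆ E f
    e⊆f = subst (_⊆ E f) (sym X≡a+T) (⁅z⁆∪p⊆q (T'⊆f (subst (a ∈_) (sym T'≡a+C) u∈⁅u⁆∪p)) T⊆f)

  -- Key lemma: in a 2-hypertree an edge shares at most one of its cores with other
  -- edges; otherwise the three edges involved would form a walk of length 3.
  at-most-one-shared-core : T ≢ T' → T CoreOf e → T' CoreOf e →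
                            SharedBeyond e T → SharedBeyond e T' → ⊥
  at-most-one-shared-core {T = T} {T' = T'} {e = e} T≢T' T-core@(∣T∣ , T⊆e) T'-core@(∣T'∣ , T'⊆e)
    (f , f≢e , T⊆f) (g , g≢e , T'⊆g)
    with edge-extends-core (∣T∣ , T⊆f) | edge-extends-core (∣T'∣ , T'⊆g)
  ... | x , _ , f≡x+T | y , _ , g≡y+T' =
    n≮n 2 (subst (_≤ 2) length≡3 (walk-length≤2 h2 W))
    where
    open Exchange (exchange T⊆e T'⊆e (edge-size T ∣T∣) (edge-size T' ∣T'∣) T≢T')

    ∣C∣≡r : ∣ C ∣ ≡ r
    ∣C∣≡r = suc-injective (trans (sym (∣⁅z⁆∪p∣≡1+∣p∣ b∉C)) (trans (cong ∣_∣ (sym T≡b+C)) ∣T∣))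

    g≢f : g ≢ f
    g≢f refl = f≢e (sym (distinct-cores-determine-edge T≢T' T-core T'-core T⊆f T'⊆g))

    T≡C+b : T ≡ C ∪ ⁅ b ⁆
    T≡C+b = trans T≡b+C (∪-comm ⁅ b ⁆ C)

    g≡y+a+C : E g ≡ ⁅ y ⁆ ∪ ⁅ a ⁆ ∪ C
    g≡y+a+C = trans g≡y+T' (cong (⁅ y ⁆ ∪_) T'≡a+C)

    e≡a+C+b : E e ≡ (⁅ a ⁆ ∪ C) ∪ ⁅ b ⁆
    e≡a+C+b = begin
      E e                   ≡⟨ X≡a+T ⟩
      ⁅ a ⁆ ∪ T             ≡⟨ cong (⁅ a ⁆ ∪_) T≡C+b ⟩
      ⁅ a ⁆ ∪ (C ∪ ⁅ b ⁆)   ≡⟨ sym (∪-assoc ⁅ a ⁆ C ⁅ b ⁆) ⟩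
      (⁅ a ⁆ ∪ C) ∪ ⁅ b ⁆   ∎

    f≡C+b+x : E f ≡ (C ∪ ⁅ b ⁆) ∪ ⁅ x ⁆
    f≡C+b+x = begin
      E f                   ≡⟨ f≡x+T ⟩
      ⁅ x ⁆ ∪ T             ≡⟨ ∪-comm ⁅ x ⁆ T ⟩
      T ∪ ⁅ x ⁆             ≡⟨ cong (_∪ ⁅ x ⁆) T≡C+b ⟩
      (C ∪ ⁅ b ⁆) ∪ ⁅ x ⁆   ∎

    three : Σ (Walk H) λ W → Walk.first W ≡ y × Walk.last W ≡ x × Walk.length W ≡ 3
    three = three-edge-walk C ∣C∣≡r y a b x g e f g≢e (f≢e ∘ sym) g≢f g≡y+a+C e≡a+C+b f≡C+b+x
    W : Walk H
    W = proj₁ three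
    length≡3 : Walk.length W ≡ 3
    length≡3 = proj₂ (proj₂ (proj₂ three))

  starAt : Subset n → Subset m
  starAt T = select (λ h → T ⊆? E h)

  ∈starAt⇔ : h ∈ starAt T ⇔ T ⊆ E h
  ∈starAt⇔ {T = T} = ∈-select⇔ (λ h → T ⊆? E h)

  e∈starAt-core : T CoreOf e → e ∈ starAt T
  e∈starAt-core (_ , T⊆e) = Equivalence.from ∈starAt⇔ T⊆e

  starAt-isStar : T CoreOf e → IsStar H (starAt T)
  starAt-isStar {T = T} {e = e} T-core@(∣T∣ , _) =
    (e , e∈starAt-core T-core) , T , ∣T∣ , λ h h∈ → Equivalence.to ∈starAt⇔ h∈

  maximal-⊆ : IsMaximalStar H S → IsStar H S' → S ⊆ S' → S ≡ S'
  maximal-⊆ {S = S} {S' = S'} (_ , no-proper-extension) S'-star S⊆S' = ⊆-antisym S⊆S' S'⊆S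
    where
    S'⊆S : S' ⊆ S
    S'⊆S {h} h∈S' with h ∈? S
    ... | yes h∈S = h∈S
    ... | no  h∉S = ⊥-elim (no-proper-extension S' S'-star (S⊆S' , h , h∈S' , h∉S))

  maximal≡starAt : IsMaximalStar H S → ∣ T ∣ ≡ suc r → (∀ h → h ∈ S → T ⊆ E h) → S ≡ starAt T
  maximal≡starAt S-max@(((e , e∈S) , _) , _) ∣T∣ core =
    maximal-⊆ S-max (starAt-isStar (∣T∣ , core e e∈S)) (λ h∈S → Equivalence.from ∈starAt⇔ (core _ h∈S))

  unshared-core-star : ¬ SharedBeyond e T → (∀ h → h ∈ S → T ⊆ E h) → e ∈ S' → S ⊆ S'
  unshared-core-star {e = e} {S' = S'} unshared core e∈S' {h} h∈S with h ≟ e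
  ... | yes refl = e∈S'
  ... | no  h≢e  = ⊥-elim (unshared (h , h≢e , core h h∈S))

  maximal-stars-disjoint : ∀ S S' → IsMaximalStar H S → IsMaximalStar H S' →
                           ∀ e → e ∈ S → e ∈ S' → S ≡ S'
  maximal-stars-disjoint S S' S-max@((_ , T , ∣T∣ , core) , _) S'-max@((_ , T' , ∣T'∣ , core') , _)
    e e∈S e∈S' with T ≟ˢ T'
  ... | yes refl = trans (maximal≡starAt S-max ∣T∣ core) (sym (maximal≡starAt S'-max ∣T'∣ core'))
  ... | no T≢T' with sharedBeyond? e T
  ...   | no  T-unshared =
    maximal-⊆ S-max (proj₁ S'-max) (unshared-core-star T-unshared core e∈S')
  ...   | yes T-shared   =
    sym (maximal-⊆ S'-max (proj₁ S-max) (unshared-core-star T'-unshared core' e∈S))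
    where
    T'-unshared : ¬ SharedBeyond e T'
    T'-unshared = at-most-one-shared-core T≢T' (∣T∣ , core e e∈S) (∣T'∣ , core' e e∈S') T-shared

  starAt-maximal : T CoreOf e → (∀ T' → T' CoreOf e → T' ≢ T → ¬ SharedBeyond e T') →
                   IsMaximalStar H (starAt T)
  starAt-maximal {T = T} {e = e} T-core others-unshared = starAt-isStar T-core , no-proper-extension
    where
    no-proper-extension : ∀ S' → IsStar H S' → ¬ (starAt T ⊂ S')
    no-proper-extension S' (_ , T' , ∣T'∣ , core') (⊆S' , w , w∈S' , w∉) with T' ≟ˢ T
    ... | yes refl = w∉ (Equivalence.from ∈starAt⇔ (core' w w∈S'))
    ... | no  T'≢T = others-unshared T' (∣T'∣ , core' e (⊆S' (e∈starAt-core T-core))) T'≢T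
                       (w , (λ { refl → w∉ (e∈starAt-core T-core) }) , core' w w∈S')

  -- Existence: every edge lies in a maximal star, namely the star of a shared core
  -- of the edge, or of any core if none is shared.
  edge-in-maximal-star : ∀ e → ∃ λ S → IsMaximalStar H S × e ∈ S
  edge-in-maximal-star e with anySubset? (λ T → coreOf? T e ×-dec sharedBeyond? e T)
  ... | yes (T , T-core , T-shared) =
    starAt T , starAt-maximal T-core (λ T' T'-core T'≢T T'-shared →
                 at-most-one-shared-core T'≢T T'-core T-core T'-shared T-shared)
             , e∈starAt-core T-core
  ... | no  no-shared-core with some-core e
  ...   | T , T-core =
    starAt T , starAt-maximal T-core (λ T' T'-core _ T'-shared → no-shared-core (T' , T'-core , T'-shared))
             , e∈starAt-core T-core

corollary4 : ∀ (n k : ℕ) → 2 ≤ k → (H : Hypergraph n k) →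
    Is2Hypertree H → MaximalStarsPartitionEdges H
corollary4 n .(suc (suc r)) (s≤s (s≤s {n = r} z≤n)) H h2 =
  edge-in-maximal-star , maximal-stars-disjoint
  where open Stars H h2
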